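{- Let $C_n$ be the cycle on $n\ge 3$ vertices and $0<\beta\le 1$. Then \[\beta\text{ -pack}(C_n)=\begin{cases}0 & 0<\beta<\tfrac12,\\ n-2 & \tfrac12\le \beta<1,\\ n-1 & \beta=1,\end{cases}\] and for every $\beta$-packing set $S$ of $C_n$ the subgraph induced by $V-S$ is connected.
   Context: Let $G=(V,E)$ be a graph, $N(v)=\{u : uv\in E\}$ the open neighborhood of $v$, and fix $\beta$ with $0<\beta\le 1$. A set $S\subsetneq V$ (a proper subset) is a $\beta$-packing set of $G$ if (i) for every $v\in V-S$, $|N(v)\cap S|\le \beta\,|N(v)|$, and (ii) $S$ is maximal with respect to inclusion among proper subsets of $V$ having property (i). The $\beta$-packing number $\beta\text{ -pack}(G)$ is the maximum cardinality of a $\beta$-packing set of $G$.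
   Formalization: The parameter β is taken to be rational. -}

module Defs where

open import Data.Nat using (ℕ; zero; suc; _+_; _≡ᵇ_)
open import Data.Bool using (Bool; true; false; _∨_; _∧_; if_then_else_)
open import Data.Fin using (Fin; toℕ)
open import Data.Fin.Subset using (Subset; _∈_; _∉_; _⊆_; _∩_; ∣_∣; ⊤; ∁)
open import Data.Vec using (tabulate)
open import Data.Integer using (+_)
open import Data.Rational using (ℚ; _/_; _≤_; _*_)
open import Relation.Binary.PropositionalEquality using (_≡_; _≢_)
open import Data.Product using (Σ; _×_)

Graph : ℕ → Set
Graph n = Fin n → Fin n → Bool

N : ∀ {n} → Graph n → Fin n → Subset n
N G v = tabulate (λ u → G v u)

cycleAdj : (n : ℕ) → Graph n
cycleAdj n u v =
  ((suc (toℕ u) ≡ᵇ toℕ v) ∨ (suc (toℕ v) ≡ᵇ toℕ u))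
  ∨ (((toℕ u ≡ᵇ 0) ∧ (suc (toℕ v) ≡ᵇ n)) ∨ ((toℕ v ≡ᵇ 0) ∧ (suc (toℕ u) ≡ᵇ n)))

ℕtoℚ : ℕ → ℚ
ℕtoℚ k = + k / 1

Prop-i : ∀ {n} → Graph n → ℚ → Subset n → Set
Prop-i G β S = ∀ v → v ∉ S → ℕtoℚ ∣ N G v ∩ S ∣ ≤ β * ℕtoℚ ∣ N G v ∣

IsβPacking : ∀ {n} → Graph n → ℚ → Subset n → Set
IsβPacking G β S =
  (S ≢ ⊤) × Prop-i G β S ×
  (∀ T → S ⊆ T → T ≢ ⊤ → Prop-i G β T → T ≡ S)

βpackIs : ∀ {n} → Graph n → ℚ → ℕ → Set
βpackIs G β k =
  Σ (Subset _) (λ S → IsβPacking G β S × ∣ S ∣ ≡ k) ×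
  (∀ S → IsβPacking G β S → ∣ S ∣ Data.Nat.≤ k)

data Reach {n} (G : Graph n) (T : Subset n) (u : Fin n) : Fin n → Set where
  here : u ∈ T → Reach G T u u
  step : ∀ {w v} → Reach G T u w → G w v ≡ true → v ∈ T → Reach G T u v

InducedConnected : ∀ {n} → Graph n → Subset n → Set
InducedConnected G T = ∀ u v → u ∈ T → v ∈ T → Reach G T u v

-- In the cycle every vertex has exactly two neighbours, so condition (i) says that a vertex
-- outside S has at most ⌊2β⌋ ∈ {0, 1, 2} neighbours in S. For ⌊2β⌋ = 0 the complement of S
-- is closed under adjacency, so by connectedness S = ∅. For ⌊2β⌋ = 2 condition (i) is void
-- and the maximal proper subsets are the complements of single vertices. For ⌊2β⌋ = 1 every
-- vertex outside S needs a neighbour outside S; the complement of any edge has this property,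
-- and a vertex v ∉ S together with a neighbour w ∉ S shows, by maximality, that S is the
-- complement of the edge vw. In all three cases V − S is a vertex or an edge, or all of V.
module Submission where

open import Defs
open import Data.Nat using (ℕ)
open import Data.Nat as ℕ using ()
open import Data.Rational using (ℚ; 0ℚ; 1ℚ; ½; _<_; _≤_)
open import Data.Fin.Subset using (∁)
open import Data.Product using (_×_)
open import Relation.Binary.PropositionalEquality using (_≡_)

import Data.Bool as Bool
open import Data.Bool.Properties using (T-≡; T-∨; T-∧; ∨-comm)
open import Data.Empty using (⊥-elim)
open import Data.Fin using (Fin; toℕ; fromℕ<) renaming (zero to fzero; suc to fsuc)
open import Data.Fin.Properties
  using (toℕ-injective; toℕ<n; toℕ-fromℕ<; fromℕ<-toℕ; fromℕ<-injective; ¬∀⟶∃¬)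
open import Data.Fin.Subset using (Subset; ⊤; ⊥; ⁅_⁆; _∪_; _∩_; _∈_; _∉_; _⊆_; ∣_∣)
open import Data.Fin.Subset.Properties
  using ( _∈?_; ∈⊤; ⊆⊤; ⊥⊆; ∉⊥; ∣⊥∣≡0; x∈⁅x⁆; x∈⁅y⁆⇒x≡y; x∈⁅y⁆⇔x≡y; ∣⁅x⁆∣≡1
        ; ⊆-antisym; p⊆q⇒∣p∣≤∣q∣; x∈p⇒x∉∁p; x∈∁p⇒x∉p; x∉∁p⇒x∈p; x∉p⇒x∈∁p; ∣∁p∣≡n∸∣p∣
        ; ∩-zeroʳ; x∈p∩q⁺; x∈p∩q⁻; ∣p∩q∣≤∣p∣; ∪-identityˡ; ∪-identityʳ; ∪-comm; ∪⇔⊎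
        ; x∈p⇒∣p-x∣<∣p∣ )
open import Data.Integer using (+_)
import Data.Integer as ℤ using (_≤_)
import Data.Integer.Properties as ℤ
open import Data.Nat using (zero; suc; z≤n; s≤s; _∸_; _≡ᵇ_)
import Data.Nat.Properties as ℕ
open import Data.Nat.Coprimality using (1-coprimeTo) renaming (sym to coprime-sym)
open import Data.Product using (Σ; ∃; ∃₂; _,_; proj₁; proj₂)
open import Data.Product.Function.NonDependent.Propositional using (_×-⇔_)
open import Data.Rational using (mkℚ; *≤*; _*_; _<?_)
open import Data.Rational.Properties
  using ( normalize-coprime; ≤-refl; ≤-trans; ≤-<-trans; <-irrefl; <⇒≤; ≮⇒≥; ≤-antisym
        ; *-monoʳ-≤-nonNeg; *-monoˡ-<-pos )
open import Data.Sum using (_⊎_; inj₁; inj₂; [_,_]; [_,_]′)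
open import Data.Sum.Function.Propositional using (_⊎-⇔_)
open import Data.Vec.Properties using (lookup∘tabulate; []=⇒lookup; lookup⇒[]=)
open import Function using (_∘_)
open import Function.Bundles using (_⇔_; mk⇔; Equivalence)
open import Function.Construct.Composition using (_⇔-∘_)
open import Function.Construct.Symmetry using (⇔-sym)
open import Relation.Binary.PropositionalEquality
  using (_≢_; refl; sym; trans; cong; cong₂; subst; subst₂)
open import Relation.Nullary using (yes; no; contradiction)
open import Relation.Nullary.Decidable using (toWitness)

open Equivalence using (to; from)

private variable
  n k c d : ℕ
  β : ℚ
  G : Graph n
  P Q : Subset n → Set
  p S T T′ : Subset n
  u v w x y z : Fin n

ℕtoℚ≡mkℚ : ∀ i → ℕtoℚ i ≡ mkℚ (+ i) 0 (coprime-sym (1-coprimeTo i))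
ℕtoℚ≡mkℚ i = normalize-coprime (coprime-sym (1-coprimeTo i))

ℕtoℚ-mono-≤ : ∀ {i j} → i ℕ.≤ j → ℕtoℚ i ≤ ℕtoℚ j
ℕtoℚ-mono-≤ {i} {j} i≤j rewrite ℕtoℚ≡mkℚ i | ℕtoℚ≡mkℚ j =
  *≤* (subst₂ ℤ._≤_ (sym (ℤ.*-identityʳ (+ i))) (sym (ℤ.*-identityʳ (+ j))) (ℤ.+≤+ i≤j))

ℕtoℚ≤⇔≤floor : ∀ {q} → ℕtoℚ k ≤ q → q < ℕtoℚ (suc k) → ∀ x → ℕtoℚ x ≤ q ⇔ x ℕ.≤ k
ℕtoℚ≤⇔≤floor {k} {q} k≤q q<k+1 x = mk⇔ below (λ x≤k → ≤-trans (ℕtoℚ-mono-≤ x≤k) k≤q)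
  where
  below : ℕtoℚ x ≤ q → x ℕ.≤ k
  below x≤q with x ℕ.≤? k
  ... | yes x≤k = x≤k
  ... | no x≰k = ⊥-elim (<-irrefl refl (≤-<-trans (ℕtoℚ-mono-≤ (ℕ.≰⇒> x≰k)) (≤-<-trans x≤q q<k+1)))

≤2β⇔≤0 : 0ℚ < β → β < ½ → ∀ x → ℕtoℚ x ≤ β * ℕtoℚ 2 ⇔ x ℕ.≤ 0
≤2β⇔≤0 0<β β<½ = ℕtoℚ≤⇔≤floor (*-monoʳ-≤-nonNeg (ℕtoℚ 2) (<⇒≤ 0<β)) (*-monoˡ-<-pos (ℕtoℚ 2) β<½)

≤2β⇔≤1 : ½ ≤ β → β < 1ℚ → ∀ x → ℕtoℚ x ≤ β * ℕtoℚ 2 ⇔ x ℕ.≤ 1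
≤2β⇔≤1 ½≤β β<1 = ℕtoℚ≤⇔≤floor (*-monoʳ-≤-nonNeg (ℕtoℚ 2) ½≤β) (*-monoˡ-<-pos (ℕtoℚ 2) β<1)

≤2β⇔≤2 : β ≡ 1ℚ → ∀ x → ℕtoℚ x ≤ β * ℕtoℚ 2 ⇔ x ℕ.≤ 2
≤2β⇔≤2 refl = ℕtoℚ≤⇔≤floor ≤-refl (toWitness {a? = 1ℚ * ℕtoℚ 2 <? ℕtoℚ 3} _)

<½⊎½≤<1⊎≡1 : β ≤ 1ℚ → β < ½ ⊎ (½ ≤ β × β < 1ℚ) ⊎ β ≡ 1ℚ
<½⊎½≤<1⊎≡1 {β} β≤1 with β <? ½ | β <? 1ℚ
... | yes β<½ | _       = inj₁ β<½
... | no β≮½  | yes β<1 = inj₂ (inj₁ (≮⇒≥ β≮½ , β<1))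
... | no _    | no β≮1  = inj₂ (inj₂ (≤-antisym β≤1 (≮⇒≥ β≮1)))

∣⁅x⁆∪⁅y⁆∣≡2 : x ≢ y → ∣ ⁅ x ⁆ ∪ ⁅ y ⁆ ∣ ≡ 2
∣⁅x⁆∪⁅y⁆∣≡2 {x = fzero}  {y = fzero}  x≢y = contradiction refl x≢y
∣⁅x⁆∪⁅y⁆∣≡2 {x = fzero}  {y = fsuc y} _   = cong suc (trans (cong ∣_∣ (∪-identityˡ ⁅ y ⁆)) (∣⁅x⁆∣≡1 y))
∣⁅x⁆∪⁅y⁆∣≡2 {x = fsuc x} {y = fzero}  _   = cong suc (trans (cong ∣_∣ (∪-identityʳ ⁅ x ⁆)) (∣⁅x⁆∣≡1 x))
∣⁅x⁆∪⁅y⁆∣≡2 {x = fsuc x} {y = fsuc y} x≢y = ∣⁅x⁆∪⁅y⁆∣≡2 (x≢y ∘ cong fsuc)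

∣∁⁅x⁆∣≡n∸1 : (x : Fin n) → ∣ ∁ ⁅ x ⁆ ∣ ≡ n ∸ 1
∣∁⁅x⁆∣≡n∸1 {n} x = trans (∣∁p∣≡n∸∣p∣ ⁅ x ⁆) (cong (n ∸_) (∣⁅x⁆∣≡1 x))

∣∁[⁅x⁆∪⁅y⁆]∣≡n∸2 : ∀ {n} {x y : Fin n} → x ≢ y → ∣ ∁ (⁅ x ⁆ ∪ ⁅ y ⁆) ∣ ≡ n ∸ 2
∣∁[⁅x⁆∪⁅y⁆]∣≡n∸2 {n} {x} {y} x≢y = trans (∣∁p∣≡n∸∣p∣ (⁅ x ⁆ ∪ ⁅ y ⁆)) (cong (n ∸_) (∣⁅x⁆∪⁅y⁆∣≡2 x≢y))

x∈p⇒0<∣p∣ : x ∈ p → 0 ℕ.< ∣ p ∣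
x∈p⇒0<∣p∣ x∈p = ℕ.≤-trans (s≤s z≤n) (x∈p⇒∣p-x∣<∣p∣ x∈p)

∈⁅x⁆∪⁅y⁆⇔ : z ∈ ⁅ x ⁆ ∪ ⁅ y ⁆ ⇔ (z ≡ x ⊎ z ≡ y)
∈⁅x⁆∪⁅y⁆⇔ = (x∈⁅y⁆⇔x≡y ⊎-⇔ x∈⁅y⁆⇔x≡y) ⇔-∘ ∪⇔⊎

x∈∁∁p⇒x∈p : x ∈ ∁ (∁ p) → x ∈ p
x∈∁∁p⇒x∈p = x∉∁p⇒x∈p ∘ x∈∁p⇒x∉p

x∈p⇒x∈∁∁p : x ∈ p → x ∈ ∁ (∁ p)
x∈p⇒x∈∁∁p = x∉p⇒x∈∁p ∘ x∈p⇒x∉∁p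

x∉p⇒p≢⊤ : x ∉ p → p ≢ ⊤
x∉p⇒p≢⊤ {x = x} x∉p refl = x∉p ∈⊤

p≢⊤⇒∃∉ : p ≢ ⊤ → ∃ λ x → x ∉ p
p≢⊤⇒∃∉ {n} {p} p≢⊤ = ¬∀⟶∃¬ n (_∈ p) (_∈? p) (λ ∀∈p → p≢⊤ (⊆-antisym ⊆⊤ (λ {x} _ → ∀∈p x)))

x∉p⇒p⊆∁⁅x⁆ : x ∉ p → p ⊆ ∁ ⁅ x ⁆
x∉p⇒p⊆∁⁅x⁆ {p = p} x∉p z∈p = x∉p⇒x∈∁p (λ z∈⁅x⁆ → x∉p (subst (_∈ p) (x∈⁅y⁆⇒x≡y _ z∈⁅x⁆) z∈p))

x,y∉p⇒p⊆∁[⁅x⁆∪⁅y⁆] : x ∉ p → y ∉ p → p ⊆ ∁ (⁅ x ⁆ ∪ ⁅ y ⁆)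
x,y∉p⇒p⊆∁[⁅x⁆∪⁅y⁆] x∉p y∉p z∈p =
  x∉p⇒x∈∁p ([ (λ { refl → x∉p z∈p }) , (λ { refl → y∉p z∈p }) ] ∘ to ∈⁅x⁆∪⁅y⁆⇔)

[⁅x⁆∪⁅y⁆]∩p⊆⁅y⁆ : ∀ {n} {x y : Fin n} {p} → x ∉ p → (⁅ x ⁆ ∪ ⁅ y ⁆) ∩ p ⊆ ⁅ y ⁆
[⁅x⁆∪⁅y⁆]∩p⊆⁅y⁆ {x = x} {y} {p} x∉p z∈ with x∈p∩q⁻ (⁅ x ⁆ ∪ ⁅ y ⁆) p z∈
... | z∈xy , z∈p with to ∈⁅x⁆∪⁅y⁆⇔ z∈xy
...   | inj₁ refl = contradiction z∈p x∉p
...   | inj₂ refl = x∈⁅x⁆ y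

∣[⁅x⁆∪⁅y⁆]∩p∣≤1⇔ : x ≢ y → ∣ (⁅ x ⁆ ∪ ⁅ y ⁆) ∩ p ∣ ℕ.≤ 1 ⇔ (x ∉ p ⊎ y ∉ p)
∣[⁅x⁆∪⁅y⁆]∩p∣≤1⇔ {x = x} {y = y} {p = p} x≢y = mk⇔ one-outside [ at-most-one , swapped ]
  where
  at-most-one : ∀ {x y} → x ∉ p → ∣ (⁅ x ⁆ ∪ ⁅ y ⁆) ∩ p ∣ ℕ.≤ 1
  at-most-one {x} {y} x∉p =
    subst (∣ (⁅ x ⁆ ∪ ⁅ y ⁆) ∩ p ∣ ℕ.≤_) (∣⁅x⁆∣≡1 y) (p⊆q⇒∣p∣≤∣q∣ ([⁅x⁆∪⁅y⁆]∩p⊆⁅y⁆ {y = y} x∉p))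
  swapped : y ∉ p → ∣ (⁅ x ⁆ ∪ ⁅ y ⁆) ∩ p ∣ ℕ.≤ 1
  swapped y∉p = subst (λ q → ∣ q ∩ p ∣ ℕ.≤ 1) (∪-comm ⁅ y ⁆ ⁅ x ⁆) (at-most-one y∉p)
  one-outside : ∣ (⁅ x ⁆ ∪ ⁅ y ⁆) ∩ p ∣ ℕ.≤ 1 → x ∉ p ⊎ y ∉ p
  one-outside ≤1 with x ∈? p | y ∈? p
  ... | no x∉p | _      = inj₁ x∉p
  ... | yes _  | no y∉p = inj₂ y∉p
  ... | yes x∈p | yes y∈p =
    ⊥-elim (ℕ.≤⇒≯ ≤1 (subst (ℕ._≤ ∣ (⁅ x ⁆ ∪ ⁅ y ⁆) ∩ p ∣) (∣⁅x⁆∪⁅y⁆∣≡2 x≢y) (p⊆q⇒∣p∣≤∣q∣ ⊆∩p)))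
    where
    ⊆∩p : ⁅ x ⁆ ∪ ⁅ y ⁆ ⊆ (⁅ x ⁆ ∪ ⁅ y ⁆) ∩ p
    ⊆∩p z∈xy = x∈p∩q⁺ (z∈xy , [ (λ { refl → x∈p }) , (λ { refl → y∈p }) ] (to ∈⁅x⁆∪⁅y⁆⇔ z∈xy))

∈N⇔ : (G : Graph n) → u ∈ N G v ⇔ G v u ≡ Bool.true
∈N⇔ {u = u} {v = v} G = mk⇔
  (λ u∈N → trans (sym (lookup∘tabulate (G v) u)) ([]=⇒lookup u∈N))
  (λ Gvu → lookup⇒[]= u (N G v) (trans (lookup∘tabulate (G v) u) Gvu))

Symmetric : Graph n → Set
Symmetric G = ∀ u v → G u v ≡ G v u

Loopless : Graph n → Set
Loopless G = ∀ v → v ∉ N G v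

Regular : Graph n → ℕ → Set
Regular G d = ∀ v → ∣ N G v ∣ ≡ d

TwoRegular : Graph n → Set
TwoRegular G = ∀ v → ∃₂ λ a b → a ≢ b × N G v ≡ ⁅ a ⁆ ∪ ⁅ b ⁆

Connected : Graph n → Set
Connected G = ∀ u v → Reach G ⊤ u v

∈N-sym : Symmetric G → u ∈ N G v → v ∈ N G u
∈N-sym {G = G} symG u∈Nv = from (∈N⇔ G) (trans (symG _ _) (to (∈N⇔ G) u∈Nv))

TwoRegular⇒Regular : TwoRegular G → Regular G 2
TwoRegular⇒Regular two v with two v
... | a , b , a≢b , N≡ab = trans (cong ∣_∣ N≡ab) (∣⁅x⁆∪⁅y⁆∣≡2 a≢b)

Reach-target : Reach G T u v → v ∈ T
Reach-target (here u∈T)     = u∈T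
Reach-target (step _ _ v∈T) = v∈T

Reach-trans : Reach G T u v → Reach G T v w → Reach G T u w
Reach-trans r (here _)        = r
Reach-trans r (step r′ e w∈T) = step (Reach-trans r r′) e w∈T

Reach-sym : Symmetric G → Reach G T u v → Reach G T v u
Reach-sym symG (here u∈T)      = here u∈T
Reach-sym symG (step r e v∈T) =
  Reach-trans (step (here v∈T) (trans (symG _ _) e) (Reach-target r)) (Reach-sym symG r)

Reach-mono : T ⊆ T′ → Reach G T u v → Reach G T′ u v
Reach-mono T⊆T′ (here u∈T)     = here (T⊆T′ u∈T)
Reach-mono T⊆T′ (step r e v∈T) = step (Reach-mono T⊆T′ r) e (T⊆T′ v∈T)

InducedConnected-∁∁ : InducedConnected G T → InducedConnected G (∁ (∁ T))
InducedConnected-∁∁ conn u v u∈ v∈ = Reach-mono x∈p⇒x∈∁∁p (conn u v (x∈∁∁p⇒x∈p u∈) (x∈∁∁p⇒x∈p v∈))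

⁅x⁆-connected : InducedConnected G ⁅ x ⁆
⁅x⁆-connected {x = x} u v u∈ v∈ with x∈⁅y⁆⇒x≡y x u∈ | x∈⁅y⁆⇒x≡y x v∈
... | refl | refl = here u∈

edge-connected : Symmetric G → w ∈ N G v → InducedConnected G (⁅ v ⁆ ∪ ⁅ w ⁆)
edge-connected {G = G} {w = w} {v = v} symG w∈Nv u u′ u∈ u′∈ with to ∈⁅x⁆∪⁅y⁆⇔ u∈ | to ∈⁅x⁆∪⁅y⁆⇔ u′∈
... | inj₁ refl | inj₁ refl = here u∈
... | inj₁ refl | inj₂ refl = step (here u∈) (to (∈N⇔ G) w∈Nv) u′∈
... | inj₂ refl | inj₁ refl = step (here u∈) (to (∈N⇔ G) (∈N-sym symG w∈Nv)) u′∈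
... | inj₂ refl | inj₂ refl = here u∈

Bounded : Graph n → ℕ → Subset n → Set
Bounded G k S = ∀ v → v ∉ S → ∣ N G v ∩ S ∣ ℕ.≤ k

Regular⇒Bounded : Regular G d → Bounded G d S
Regular⇒Bounded {G = G} {S = S} reg v _ = subst (∣ N G v ∩ S ∣ ℕ.≤_) (reg v) (∣p∩q∣≤∣p∣ (N G v) S)

Prop-i⇔Bounded : ∀ {n} {G : Graph n} {β d k} → Regular G d →
                 (∀ x → ℕtoℚ x ≤ β * ℕtoℚ d ⇔ x ℕ.≤ k) → ∀ S → Prop-i G β S ⇔ Bounded G k S
Prop-i⇔Bounded {n} {G} {β} reg ≤βd⇔≤k S = mk⇔
  (λ prop v v∉S → to (≤βd⇔≤k _) (subst (bound v) (reg v) (prop v v∉S)))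
  (λ bnd v v∉S → subst (bound v) (sym (reg v)) (from (≤βd⇔≤k _) (bnd v v∉S)))
  where
  bound : Fin n → ℕ → Set
  bound v d = ℕtoℚ ∣ N G v ∩ S ∣ ≤ β * ℕtoℚ d

-- IsβPacking G β is, by unfolding, MaximalProper (Prop-i G β).
MaximalProper : (Subset n → Set) → Subset n → Set
MaximalProper P S = S ≢ ⊤ × P S × (∀ T → S ⊆ T → T ≢ ⊤ → P T → T ≡ S)

MaximalProper-⇔ : (∀ S → P S ⇔ Q S) → MaximalProper P S → MaximalProper Q S
MaximalProper-⇔ P⇔Q (S≢⊤ , PS , maximal) =
  S≢⊤ , to (P⇔Q _) PS , λ T S⊆T T≢⊤ QT → maximal T S⊆T T≢⊤ (from (P⇔Q T) QT)

record Packings (G : Graph n) (P : Subset n → Set) (c : ℕ) : Set where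
  field
    example      : Σ (Subset n) λ S → P S × ∣ S ∣ ≡ c
    size         : P S → ∣ S ∣ ≡ c
    co-connected : P S → InducedConnected G (∁ S)

Packings-⇔ : (∀ S → P S ⇔ Q S) → Packings G (MaximalProper P) c → Packings G (MaximalProper Q) c
Packings-⇔ P⇔Q packings with Packings.example packings
... | S , pS , ∣S∣≡c = record
  { example      = S , MaximalProper-⇔ P⇔Q pS , ∣S∣≡c
  ; size         = size ∘ MaximalProper-⇔ (⇔-sym ∘ P⇔Q)
  ; co-connected = co-connected ∘ MaximalProper-⇔ (⇔-sym ∘ P⇔Q)
  }
  where open Packings packings

βpackIs-from : Packings G (IsβPacking G β) c → βpackIs G β c
βpackIs-from packings = example , λ S → ℕ.≤-reflexive ∘ size
  where open Packings packings

Bounded-0-closed : Bounded G 0 S → v ∉ S → Reach G T v u → u ∉ S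
Bounded-0-closed bnd v∉S (here _) = v∉S
Bounded-0-closed {G = G} {S = S} bnd v∉S (step {w} r Gwu _) u∈S =
  ℕ.≤⇒≯ (bnd w (Bounded-0-closed bnd v∉S r)) (x∈p⇒0<∣p∣ (x∈p∩q⁺ (from (∈N⇔ G) Gwu , u∈S)))

Bounded-0⇒≡⊥ : Connected G → S ≢ ⊤ → Bounded G 0 S → S ≡ ⊥
Bounded-0⇒≡⊥ conn S≢⊤ bnd with p≢⊤⇒∃∉ S≢⊤
... | v , v∉S = ⊆-antisym (λ {u} u∈S → ⊥-elim (Bounded-0-closed bnd v∉S (conn v u) u∈S)) ⊥⊆

⊥-packings : ∀ {n} {G : Graph n} → Connected G → Fin n → Packings G (MaximalProper (Bounded G 0)) 0
⊥-packings {n} {G} conn x = record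
  { example      = ⊥ , (x∉p⇒p≢⊤ (∉⊥ {x = x}) , ⊥-bounded , λ T _ T≢⊤ → Bounded-0⇒≡⊥ conn T≢⊤) , ∣⊥∣≡0 n
  ; size         = λ packing → trans (cong ∣_∣ (≡⊥ packing)) (∣⊥∣≡0 n)
  ; co-connected = λ packing u v _ _ →
                     Reach-mono (λ _ → x∉p⇒x∈∁p (subst (_ ∉_) (sym (≡⊥ packing)) ∉⊥)) (conn u v)
  }
  where
  ≡⊥ : MaximalProper (Bounded G 0) S → S ≡ ⊥
  ≡⊥ (S≢⊤ , bnd , _) = Bounded-0⇒≡⊥ conn S≢⊤ bnd
  ⊥-bounded : Bounded G 0 ⊥
  ⊥-bounded v _ = ℕ.≤-reflexive (trans (cong ∣_∣ (∩-zeroʳ (N G v))) (∣⊥∣≡0 n))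

∁⁅x⁆-maximal : ∁ ⁅ x ⁆ ⊆ T → T ≢ ⊤ → T ≡ ∁ ⁅ x ⁆
∁⁅x⁆-maximal {x = x} {T = T} ∁⁅x⁆⊆T T≢⊤ with p≢⊤⇒∃∉ T≢⊤
... | y , y∉T with x∈⁅y⁆⇒x≡y x (x∉∁p⇒x∈p (y∉T ∘ ∁⁅x⁆⊆T))
...   | refl = ⊆-antisym (x∉p⇒p⊆∁⁅x⁆ y∉T) ∁⁅x⁆⊆T

∁⁅x⁆-packings : ∀ {n} {G : Graph n} {P : Subset n → Set} →
                (∀ S → P S) → Fin n → Packings G (MaximalProper P) (n ∸ 1)
∁⁅x⁆-packings {P = P} always x = record
  { example      = ∁ ⁅ x ⁆ , ∁⁅x⁆-maximalProper x , ∣∁⁅x⁆∣≡n∸1 x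
  ; size         = λ packing → let (v , ∁⁅v⁆≡S) = ≡∁⁅x⁆ packing in
                     subst (λ S → ∣ S ∣ ≡ _) ∁⁅v⁆≡S (∣∁⁅x⁆∣≡n∸1 v)
  ; co-connected = λ packing → let (v , ∁⁅v⁆≡S) = ≡∁⁅x⁆ packing in
                     subst (InducedConnected _ ∘ ∁) ∁⁅v⁆≡S (InducedConnected-∁∁ ⁅x⁆-connected)
  }
  where
  ∁⁅x⁆-maximalProper : ∀ x → MaximalProper P (∁ ⁅ x ⁆)
  ∁⁅x⁆-maximalProper x = x∉p⇒p≢⊤ (x∈p⇒x∉∁p (x∈⁅x⁆ x)) , always _ , λ T ⊆T T≢⊤ _ → ∁⁅x⁆-maximal ⊆T T≢⊤
  ≡∁⁅x⁆ : MaximalProper P S → ∃ λ v → ∁ ⁅ v ⁆ ≡ S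
  ≡∁⁅x⁆ (S≢⊤ , _ , maximal) with p≢⊤⇒∃∉ S≢⊤
  ... | v , v∉S = v , maximal (∁ ⁅ v ⁆) (x∉p⇒p⊆∁⁅x⁆ v∉S) (proj₁ (∁⁅x⁆-maximalProper v)) (always _)

Bounded-1⇔neighbour∉ : TwoRegular G → ∣ N G v ∩ S ∣ ℕ.≤ 1 ⇔ (∃ λ u → u ∈ N G v × u ∉ S)
Bounded-1⇔neighbour∉ {G = G} {v = v} {S = S} two with two v
... | a , b , a≢b , N≡ab rewrite N≡ab = mk⇔
  ([ (λ a∉S → a , a∈ab , a∉S) , (λ b∉S → b , b∈ab , b∉S) ] ∘ to (∣[⁅x⁆∪⁅y⁆]∩p∣≤1⇔ a≢b))
  (λ (u , u∈ab , u∉S) → from (∣[⁅x⁆∪⁅y⁆]∩p∣≤1⇔ a≢b)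
    ([ (λ { refl → inj₁ u∉S }) , (λ { refl → inj₂ u∉S }) ] (to ∈⁅x⁆∪⁅y⁆⇔ u∈ab)))
  where
  a∈ab : a ∈ ⁅ a ⁆ ∪ ⁅ b ⁆
  a∈ab = from ∈⁅x⁆∪⁅y⁆⇔ (inj₁ refl)
  b∈ab : b ∈ ⁅ a ⁆ ∪ ⁅ b ⁆
  b∈ab = from ∈⁅x⁆∪⁅y⁆⇔ (inj₂ refl)

module _ (G : Graph n) (symG : Symmetric G) (loopless : Loopless G) (two : TwoRegular G) where

  edge-complement-maximal : w ∈ N G v → MaximalProper (Bounded G 1) (∁ (⁅ v ⁆ ∪ ⁅ w ⁆))
  edge-complement-maximal {w = w} {v = v} w∈Nv = x∉p⇒p≢⊤ v∉E , bounded , maximal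
    where
    E : Subset n
    E = ∁ (⁅ v ⁆ ∪ ⁅ w ⁆)
    v∉E : v ∉ E
    v∉E = x∈p⇒x∉∁p (from ∈⁅x⁆∪⁅y⁆⇔ (inj₁ refl))
    w∉E : w ∉ E
    w∉E = x∈p⇒x∉∁p (from ∈⁅x⁆∪⁅y⁆⇔ (inj₂ refl))
    endpoint : z ∉ E → z ≡ v ⊎ z ≡ w
    endpoint = to ∈⁅x⁆∪⁅y⁆⇔ ∘ x∉∁p⇒x∈p
    bounded : Bounded G 1 E
    bounded z z∉E with endpoint z∉E
    ... | inj₁ refl = from (Bounded-1⇔neighbour∉ two) (w , w∈Nv , w∉E)
    ... | inj₂ refl = from (Bounded-1⇔neighbour∉ two) (v , ∈N-sym symG w∈Nv , v∉E)
    maximal : ∀ T → E ⊆ T → T ≢ ⊤ → Bounded G 1 T → T ≡ E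
    maximal T E⊆T T≢⊤ bnd with p≢⊤⇒∃∉ T≢⊤
    ... | x , x∉T with to (Bounded-1⇔neighbour∉ two) (bnd x x∉T)
    ...   | y , y∈Nx , y∉T = ⊆-antisym (x,y∉p⇒p⊆∁[⁅x⁆∪⁅y⁆] (proj₁ ends∉T) (proj₂ ends∉T)) E⊆T
      where
      ends∉T : v ∉ T × w ∉ T
      ends∉T with endpoint (x∉T ∘ E⊆T) | endpoint (y∉T ∘ E⊆T)
      ... | inj₁ refl | inj₁ refl = ⊥-elim (loopless x y∈Nx)
      ... | inj₁ refl | inj₂ refl = x∉T , y∉T
      ... | inj₂ refl | inj₁ refl = y∉T , x∉T
      ... | inj₂ refl | inj₂ refl = ⊥-elim (loopless x y∈Nx)

  maximal⇒edge-complement : MaximalProper (Bounded G 1) S → ∃₂ λ v w → w ∈ N G v × ∁ (⁅ v ⁆ ∪ ⁅ w ⁆) ≡ S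
  maximal⇒edge-complement (S≢⊤ , bnd , maximal) with p≢⊤⇒∃∉ S≢⊤
  ... | v , v∉S with to (Bounded-1⇔neighbour∉ two) (bnd v v∉S)
  ...   | w , w∈Nv , w∉S with edge-complement-maximal w∈Nv
  ...     | E≢⊤ , E-bounded , _ = v , w , w∈Nv , maximal _ (x,y∉p⇒p⊆∁[⁅x⁆∪⁅y⁆] v∉S w∉S) E≢⊤ E-bounded

  edge-complement-packings : ∀ v w → w ∈ N G v → Packings G (MaximalProper (Bounded G 1)) (n ∸ 2)
  edge-complement-packings _ _ w∈Nv = record
    { example      = _ , edge-complement-maximal w∈Nv , ∣∁[⁅x⁆∪⁅y⁆]∣≡n∸2 (≢-neighbour w∈Nv)
    ; size         = λ packing → let (v , w , w∈Nv , E≡S) = maximal⇒edge-complement packing in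
                       subst (λ S → ∣ S ∣ ≡ n ∸ 2) E≡S (∣∁[⁅x⁆∪⁅y⁆]∣≡n∸2 (≢-neighbour w∈Nv))
    ; co-connected = λ packing → let (v , w , w∈Nv , E≡S) = maximal⇒edge-complement packing in
                       subst (InducedConnected G ∘ ∁) E≡S
                         (InducedConnected-∁∁ (edge-connected symG w∈Nv))
    }
    where
    ≢-neighbour : w ∈ N G v → v ≢ w
    ≢-neighbour w∈Nv refl = loopless _ w∈Nv

Adjacent : ℕ → ℕ → ℕ → Set
Adjacent n i j = (suc i ≡ j ⊎ suc j ≡ i) ⊎ ((i ≡ 0 × suc j ≡ n) ⊎ (j ≡ 0 × suc i ≡ n))

cycleAdj⇔Adjacent : ∀ {n} {u v : Fin n} → cycleAdj n u v ≡ Bool.true ⇔ Adjacent n (toℕ u) (toℕ v)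
cycleAdj⇔Adjacent =
  (((≡ᵇ⇔≡ ⊎-⇔ ≡ᵇ⇔≡) ⊎-⇔ (((≡ᵇ⇔≡ ×-⇔ ≡ᵇ⇔≡) ⇔-∘ T-∧) ⊎-⇔ ((≡ᵇ⇔≡ ×-⇔ ≡ᵇ⇔≡) ⇔-∘ T-∧)))
     ⇔-∘ ((T-∨ ⊎-⇔ T-∨) ⇔-∘ T-∨))
  ⇔-∘ ⇔-sym T-≡
  where
  ≡ᵇ⇔≡ : ∀ {i j} → Bool.T (i ≡ᵇ j) ⇔ i ≡ j
  ≡ᵇ⇔≡ {i} {j} = mk⇔ (ℕ.≡ᵇ⇒≡ i j) (ℕ.≡⇒≡ᵇ i j)

module Cycle (m : ℕ) where

  n′ : ℕ
  n′ = suc (suc (suc m))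

  C : Graph n′
  C = cycleAdj n′

  1≢n′ : 1 ≢ n′
  1≢n′ ()

  NeighboursAt : ℕ → Set
  NeighboursAt i = ∃₂ λ a b → a ℕ.< n′ × b ℕ.< n′ × a ≢ b ×
                   (∀ j → j ℕ.< n′ → Adjacent n′ i j ⇔ (j ≡ a ⊎ j ≡ b))

  neighbours-first : NeighboursAt 0
  neighbours-first = 1 , suc (suc m) , s≤s (s≤s z≤n) , ℕ.≤-refl , (λ ()) , λ j _ → mk⇔ classify adjacent
    where
    classify : ∀ {j} → Adjacent n′ 0 j → j ≡ 1 ⊎ j ≡ suc (suc m)
    classify (inj₁ (inj₁ refl))      = inj₁ refl
    classify (inj₂ (inj₁ (_ , j+1≡n))) = inj₂ (ℕ.suc-injective j+1≡n)
    adjacent : ∀ {j} → j ≡ 1 ⊎ j ≡ suc (suc m) → Adjacent n′ 0 j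
    adjacent (inj₁ refl) = inj₁ (inj₁ refl)
    adjacent (inj₂ refl) = inj₂ (inj₁ (refl , refl))

  neighbours-inner : ∀ i → suc (suc i) ℕ.< n′ → NeighboursAt (suc i)
  neighbours-inner i i+2<n =
    suc (suc i) , i , i+2<n , ℕ.<-trans i<i+2 i+2<n , ℕ.>⇒≢ i<i+2 , λ j _ → mk⇔ classify adjacent
    where
    i<i+2 : i ℕ.< suc (suc i)
    i<i+2 = ℕ.<-trans (ℕ.n<1+n i) (ℕ.n<1+n (suc i))
    classify : ∀ {j} → Adjacent n′ (suc i) j → j ≡ suc (suc i) ⊎ j ≡ i
    classify (inj₁ (inj₁ refl))    = inj₁ refl
    classify (inj₁ (inj₂ j+1≡i+1)) = inj₂ (ℕ.suc-injective j+1≡i+1)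
    classify (inj₂ (inj₂ (_ , i+2≡n))) = ⊥-elim (ℕ.<-irrefl i+2≡n i+2<n)
    adjacent : ∀ {j} → j ≡ suc (suc i) ⊎ j ≡ i → Adjacent n′ (suc i) j
    adjacent (inj₁ refl) = inj₁ (inj₁ refl)
    adjacent (inj₂ refl) = inj₁ (inj₂ refl)

  neighbours-last : NeighboursAt (suc (suc m))
  neighbours-last = 0 , suc m , s≤s z≤n , ℕ.<-trans (ℕ.n<1+n (suc m)) (ℕ.n<1+n (suc (suc m))) , (λ ()) ,
                    λ j j<n → mk⇔ (classify j<n) adjacent
    where
    classify : ∀ {j} → j ℕ.< n′ → Adjacent n′ (suc (suc m)) j → j ≡ 0 ⊎ j ≡ suc m
    classify j<n (inj₁ (inj₁ refl))      = ⊥-elim (ℕ.<-irrefl refl j<n)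
    classify _   (inj₁ (inj₂ j+1≡m+2))   = inj₂ (ℕ.suc-injective j+1≡m+2)
    classify _   (inj₂ (inj₂ (j≡0 , _))) = inj₁ j≡0
    adjacent : ∀ {j} → j ≡ 0 ⊎ j ≡ suc m → Adjacent n′ (suc (suc m)) j
    adjacent (inj₁ refl) = inj₂ (inj₂ (refl , refl))
    adjacent (inj₂ refl) = inj₁ (inj₂ refl)

  neighbours : ∀ i → i ℕ.< n′ → NeighboursAt i
  neighbours zero    _     = neighbours-first
  neighbours (suc i) i+1<n with suc (suc i) ℕ.<? n′
  ... | yes i+2<n = neighbours-inner i i+2<n
  ... | no i+2≮n with ℕ.suc-injective (ℕ.suc-injective (ℕ.≤-antisym i+1<n (ℕ.≮⇒≥ i+2≮n)))
  ...   | refl = neighbours-last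

  symmetric : Symmetric C
  symmetric u v =
    cong₂ Bool._∨_ (∨-comm (suc (toℕ u) ≡ᵇ toℕ v) _) (∨-comm ((toℕ u ≡ᵇ 0) Bool.∧ (suc (toℕ v) ≡ᵇ n′)) _)

  loopless : Loopless C
  loopless v v∈Nv with to (cycleAdj⇔Adjacent {u = v} {v = v}) (to (∈N⇔ C) v∈Nv)
  ... | inj₁ (inj₁ i+1≡i)       = ℕ.1+n≢n i+1≡i
  ... | inj₁ (inj₂ i+1≡i)       = ℕ.1+n≢n i+1≡i
  ... | inj₂ (inj₁ (i≡0 , i+1≡n)) = 1≢n′ (trans (cong suc (sym i≡0)) i+1≡n)
  ... | inj₂ (inj₂ (i≡0 , i+1≡n)) = 1≢n′ (trans (cong suc (sym i≡0)) i+1≡n)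

  toℕ≡⇔≡fromℕ< : ∀ {a} {u : Fin n′} (a<n : a ℕ.< n′) → toℕ u ≡ a ⇔ u ≡ fromℕ< a<n
  toℕ≡⇔≡fromℕ< a<n = mk⇔ (λ u≡a → toℕ-injective (trans u≡a (sym (toℕ-fromℕ< a<n))))
                         (λ { refl → toℕ-fromℕ< a<n })

  twoRegular : TwoRegular C
  twoRegular v with neighbours (toℕ v) (toℕ<n v)
  ... | a , b , a<n , b<n , a≢b , adjacent⇔ =
    fromℕ< a<n , fromℕ< b<n , a≢b ∘ fromℕ<-injective a b a<n b<n ,
    ⊆-antisym (from ∈⁅x⁆∪⁅y⁆⇔ ∘ to ∈N⇔ab) (from ∈N⇔ab ∘ to ∈⁅x⁆∪⁅y⁆⇔)
    where
    ∈N⇔ab : ∀ {u} → u ∈ N C v ⇔ (u ≡ fromℕ< a<n ⊎ u ≡ fromℕ< b<n)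
    ∈N⇔ab {u} = (toℕ≡⇔≡fromℕ< a<n ⊎-⇔ toℕ≡⇔≡fromℕ< b<n)
            ⇔-∘ (adjacent⇔ (toℕ u) (toℕ<n u) ⇔-∘ (cycleAdj⇔Adjacent ⇔-∘ ∈N⇔ C))

  regular : Regular C 2
  regular = TwoRegular⇒Regular {G = C} twoRegular

  reach-fromℕ< : ∀ j (j<n : j ℕ.< n′) → Reach C ⊤ fzero (fromℕ< j<n)
  reach-fromℕ< zero    _     = here ∈⊤
  reach-fromℕ< (suc j) j+1<n =
    step (reach-fromℕ< j j<n) (from cycleAdj⇔Adjacent (inj₁ (inj₁ j+1≡j+1))) ∈⊤
    where
    j<n : j ℕ.< n′
    j<n = ℕ.<-trans (ℕ.n<1+n j) j+1<n
    j+1≡j+1 : suc (toℕ (fromℕ< j<n)) ≡ toℕ (fromℕ< j+1<n)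
    j+1≡j+1 = trans (cong suc (toℕ-fromℕ< j<n)) (sym (toℕ-fromℕ< j+1<n))

  connected : Connected C
  connected u v = Reach-trans (Reach-sym symmetric (from-zero u)) (from-zero v)
    where
    from-zero : ∀ u → Reach C ⊤ fzero u
    from-zero u = subst (Reach C ⊤ fzero) (fromℕ<-toℕ u (toℕ<n u)) (reach-fromℕ< (toℕ u) (toℕ<n u))

  1∈N0 : fsuc fzero ∈ N C fzero
  1∈N0 = from (∈N⇔ {u = fsuc fzero} {v = fzero} C) refl

corollary2p5 : (n : ℕ) → 3 ℕ.≤ n → (β : ℚ) → 0ℚ < β → β ≤ 1ℚ →
    ((β < ½ → βpackIs (cycleAdj n) β 0) ×
     (½ ≤ β → β < 1ℚ → βpackIs (cycleAdj n) β (n ℕ.∸ 2)) ×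
     (β ≡ 1ℚ → βpackIs (cycleAdj n) β (n ℕ.∸ 1)))
    × (∀ S → IsβPacking (cycleAdj n) β S → InducedConnected (cycleAdj n) (∁ S))
corollary2p5 (suc (suc (suc m))) (s≤s (s≤s (s≤s z≤n))) β 0<β β≤1 =
  ( βpackIs-from {β = β} ∘ packings-<½
  , (λ ½≤β → βpackIs-from {β = β} ∘ packings-½≤<1 ½≤β)
  , βpackIs-from {β = β} ∘ packings-1 )
  , co-connected
  where
  open Cycle m

  βpackings : (∀ x → ℕtoℚ x ≤ β * ℕtoℚ 2 ⇔ x ℕ.≤ k) →
              Packings C (MaximalProper (Bounded C k)) c → Packings C (IsβPacking C β) c
  βpackings ≤2β⇔≤k = Packings-⇔ (⇔-sym ∘ Prop-i⇔Bounded {G = C} {β = β} regular ≤2β⇔≤k)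

  packings-<½ : β < ½ → Packings C (IsβPacking C β) 0
  packings-<½ β<½ = βpackings (≤2β⇔≤0 0<β β<½) (⊥-packings connected fzero)

  packings-½≤<1 : ½ ≤ β → β < 1ℚ → Packings C (IsβPacking C β) (suc m)
  packings-½≤<1 ½≤β β<1 =
    βpackings (≤2β⇔≤1 ½≤β β<1)
      (edge-complement-packings C symmetric loopless twoRegular fzero (fsuc fzero) 1∈N0)

  packings-1 : β ≡ 1ℚ → Packings C (IsβPacking C β) (suc (suc m))
  packings-1 β≡1 = βpackings (≤2β⇔≤2 β≡1) (∁⁅x⁆-packings (λ _ → Regular⇒Bounded {G = C} regular) fzero)

  co-connected : ∀ S → IsβPacking C β S → InducedConnected C (∁ S)
  co-connected S =
    [ (λ β<½ → Packings.co-connected (packings-<½ β<½) {S})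
    , [ (λ (½≤β , β<1) → Packings.co-connected (packings-½≤<1 ½≤β β<1) {S})
      , (λ β≡1 → Packings.co-connected (packings-1 β≡1) {S}) ]′ ]′
    (<½⊎½≤<1⊎≡1 β≤1)
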